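{- For any set $\Gamma\cup\{A\}$ of $\square$-free formulas, $\textbf{mHC}+\Gamma\vdash A$ if and only if $\textbf{Int}+\Gamma\vdash A$.
   Context: The language $\mathcal{L}$ has propositional variables $p_0,p_1,\ldots$, connectives $\wedge,\vee,\rightarrow,\neg$ and a unary modality $\square$. A substitution is an endomorphism of the algebra of $\mathcal{L}$-formulas. Let $(\mathrm{Ax}_0)$ be a standard finite list of axioms of intuitionistic propositional logic written as particular $\square$-free formulas. A derivation from axioms $X$ and premises $\Gamma$ is a finite sequence of formulas each in $X\cup\Gamma$, or obtained from an earlier formula by substitution, or from earlier $\varphi$, $\varphi\rightarrow\psi$ by modus ponens. $\textbf{mHC}+\Gamma\vdash\alpha$: $X$ consists of $(\mathrm{Ax}_0)$ together with $\square(p_0\rightarrow p_1)\rightarrow(\square p_0\rightarrow\square p_1)$, $p_0\rightarrow\square p_0$, and $\square p_0\rightarrow(p_1\vee(p_1\rightarrow p_0))$, with substitution of arbitrary $\mathcal{L}$-formulas (the modalized Heyting calculus). $\textbf{Int}+\Gamma\vdash A$: $X=(\mathrm{Ax}_0)$, only $\square$-free formulas and substitutions of $\square$-free formulas. -}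

module Defs where

open import Data.Nat using (ℕ)
open import Data.Unit using (⊤)
open import Data.Product using (_×_)
open import Level using (0ℓ)
open import Relation.Unary using (Pred)

infixr 6 _∧_
infixr 5 _∨_
infixr 4 _⇒_
data Formula : Set where
  var  : ℕ → Formula
  _∧_  : Formula → Formula → Formula
  _∨_  : Formula → Formula → Formula
  _⇒_  : Formula → Formula → Formula
  ¬′_  : Formula → Formula
  □_   : Formula → Formula

p₀ p₁ p₂ : Formula
p₀ = var 0
p₁ = var 1
p₂ = var 2

Subst : Set
Subst = ℕ → Formula

_⟨_⟩ : Formula → Subst → Formula
var n   ⟨ σ ⟩ = σ n
(a ∧ b) ⟨ σ ⟩ = a ⟨ σ ⟩ ∧ b ⟨ σ ⟩
(a ∨ b) ⟨ σ ⟩ = a ⟨ σ ⟩ ∨ b ⟨ σ ⟩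
(a ⇒ b) ⟨ σ ⟩ = a ⟨ σ ⟩ ⇒ b ⟨ σ ⟩
(¬′ a)  ⟨ σ ⟩ = ¬′ (a ⟨ σ ⟩)
(□ a)   ⟨ σ ⟩ = □ (a ⟨ σ ⟩)

data BoxFree : Formula → Set where
  var : ∀ n → BoxFree (var n)
  _∧_ : ∀ {a b} → BoxFree a → BoxFree b → BoxFree (a ∧ b)
  _∨_ : ∀ {a b} → BoxFree a → BoxFree b → BoxFree (a ∨ b)
  _⇒_ : ∀ {a b} → BoxFree a → BoxFree b → BoxFree (a ⇒ b)
  ¬′_ : ∀ {a} → BoxFree a → BoxFree (¬′ a)

data Ax₀ : Formula → Set where
  k    : Ax₀ (p₀ ⇒ (p₁ ⇒ p₀))
  s    : Ax₀ ((p₀ ⇒ (p₁ ⇒ p₂)) ⇒ ((p₀ ⇒ p₁) ⇒ (p₀ ⇒ p₂)))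
  ∧e₁  : Ax₀ (p₀ ∧ p₁ ⇒ p₀)
  ∧e₂  : Ax₀ (p₀ ∧ p₁ ⇒ p₁)
  ∧i   : Ax₀ (p₀ ⇒ (p₁ ⇒ p₀ ∧ p₁))
  ∨i₁  : Ax₀ (p₀ ⇒ p₀ ∨ p₁)
  ∨i₂  : Ax₀ (p₁ ⇒ p₀ ∨ p₁)
  ∨e   : Ax₀ ((p₀ ⇒ p₂) ⇒ ((p₁ ⇒ p₂) ⇒ (p₀ ∨ p₁ ⇒ p₂)))
  ¬i   : Ax₀ ((p₀ ⇒ p₁) ⇒ ((p₀ ⇒ ¬′ p₁) ⇒ ¬′ p₀))
  ¬e   : Ax₀ (¬′ p₀ ⇒ (p₀ ⇒ p₁))

data AxmHC : Formula → Set where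
  int : ∀ {a} → Ax₀ a → AxmHC a
  K   : AxmHC (□ (p₀ ⇒ p₁) ⇒ (□ p₀ ⇒ □ p₁))
  T′  : AxmHC (p₀ ⇒ □ p₀)
  KM  : AxmHC (□ p₀ ⇒ (p₁ ∨ (p₁ ⇒ p₀)))

data _⊢mHC_ (Γ : Pred Formula 0ℓ) : Formula → Set where
  ax   : ∀ {a} → AxmHC a → Γ ⊢mHC a
  prem : ∀ {a} → Γ a → Γ ⊢mHC a
  sub  : ∀ {a} (σ : Subst) → Γ ⊢mHC a → Γ ⊢mHC (a ⟨ σ ⟩)
  mp   : ∀ {a b} → Γ ⊢mHC a → Γ ⊢mHC (a ⇒ b) → Γ ⊢mHC b

-- Int + Γ ⊢ A : only □-free formulas; substitutions of □-free formulas only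
-- (premises from Γ are □-free by the standing hypothesis of the statement)
data _⊢Int_ (Γ : Pred Formula 0ℓ) : Formula → Set where
  ax   : ∀ {a} → Ax₀ a → Γ ⊢Int a
  prem : ∀ {a} → Γ a → Γ ⊢Int a
  sub  : ∀ {a} (σ : Subst) → (∀ n → BoxFree (σ n)) → Γ ⊢Int a → Γ ⊢Int (a ⟨ σ ⟩)
  mp   : ∀ {a b} → Γ ⊢Int a → Γ ⊢Int (a ⇒ b) → Γ ⊢Int b

-- Erasing every □ maps each mHC axiom to an Int theorem (K and T to instances
-- of a ⇒ a, KM to a consequence of a ⇒ (b ⇒ a) and ∨-introduction) and commutes
-- with substitution, so it turns an mHC-derivation from □-free premises into an
-- Int-derivation of the erased conclusion; a □-free formula is its own erasure.
-- The converse holds because every Int-derivation is already an mHC-derivation.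
module Submission where

open import Defs
open import Level using (0ℓ)
open import Relation.Unary using (Pred)
open import Function.Bundles using (_⇔_; mk⇔)
open import Data.Nat using (suc)
open import Relation.Binary.PropositionalEquality using (_≡_; refl; cong; cong₂; subst; sym)

erase : Formula → Formula
erase (var n) = var n
erase (a ∧ b) = erase a ∧ erase b
erase (a ∨ b) = erase a ∨ erase b
erase (a ⇒ b) = erase a ⇒ erase b
erase (¬′ a)  = ¬′ erase a
erase (□ a)   = erase a

erase-boxFree : ∀ a → BoxFree (erase a)
erase-boxFree (var n) = var n
erase-boxFree (a ∧ b) = erase-boxFree a ∧ erase-boxFree b
erase-boxFree (a ∨ b) = erase-boxFree a ∨ erase-boxFree b
erase-boxFree (a ⇒ b) = erase-boxFree a ⇒ erase-boxFree b
erase-boxFree (¬′ a)  = ¬′ erase-boxFree a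
erase-boxFree (□ a)   = erase-boxFree a

erase-boxFree-id : ∀ {a} → BoxFree a → erase a ≡ a
erase-boxFree-id (var n) = refl
erase-boxFree-id (x ∧ y) = cong₂ _∧_ (erase-boxFree-id x) (erase-boxFree-id y)
erase-boxFree-id (x ∨ y) = cong₂ _∨_ (erase-boxFree-id x) (erase-boxFree-id y)
erase-boxFree-id (x ⇒ y) = cong₂ _⇒_ (erase-boxFree-id x) (erase-boxFree-id y)
erase-boxFree-id (¬′ x)  = cong ¬′_ (erase-boxFree-id x)

erase-⟨⟩ : ∀ a (σ : Subst) → erase (a ⟨ σ ⟩) ≡ erase a ⟨ (λ n → erase (σ n)) ⟩
erase-⟨⟩ (var n) σ = refl
erase-⟨⟩ (a ∧ b) σ = cong₂ _∧_ (erase-⟨⟩ a σ) (erase-⟨⟩ b σ)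
erase-⟨⟩ (a ∨ b) σ = cong₂ _∨_ (erase-⟨⟩ a σ) (erase-⟨⟩ b σ)
erase-⟨⟩ (a ⇒ b) σ = cong₂ _⇒_ (erase-⟨⟩ a σ) (erase-⟨⟩ b σ)
erase-⟨⟩ (¬′ a)  σ = cong ¬′_ (erase-⟨⟩ a σ)
erase-⟨⟩ (□ a)   σ = erase-⟨⟩ a σ

erase-Ax₀ : ∀ {φ} → Ax₀ φ → erase φ ≡ φ
erase-Ax₀ k   = refl
erase-Ax₀ s   = refl
erase-Ax₀ ∧e₁ = refl
erase-Ax₀ ∧e₂ = refl
erase-Ax₀ ∧i  = refl
erase-Ax₀ ∨i₁ = refl
erase-Ax₀ ∨i₂ = refl
erase-Ax₀ ∨e  = refl
erase-Ax₀ ¬i  = refl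
erase-Ax₀ ¬e  = refl

[_,_,_] : Formula → Formula → Formula → Subst
[ a , b , c ] 0             = a
[ a , b , c ] 1             = b
[ a , b , c ] (suc (suc _)) = c

[,,]-boxFree : ∀ {a b c} → BoxFree a → BoxFree b → BoxFree c → ∀ n → BoxFree ([ a , b , c ] n)
[,,]-boxFree x y z 0             = x
[,,]-boxFree x y z 1             = y
[,,]-boxFree x y z (suc (suc _)) = z

module _ {Γ : Pred Formula 0ℓ} where

  Int-instance : ∀ {φ a b c} → BoxFree a → BoxFree b → BoxFree c →
                 Ax₀ φ → Γ ⊢Int (φ ⟨ [ a , b , c ] ⟩)
  Int-instance x y z axiom = sub _ ([,,]-boxFree x y z) (ax axiom)

  Int-K : ∀ {a b} → BoxFree a → BoxFree b → Γ ⊢Int (a ⇒ (b ⇒ a))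
  Int-K x y = Int-instance x y x k

  Int-S : ∀ {a b c} → BoxFree a → BoxFree b → BoxFree c →
          Γ ⊢Int ((a ⇒ (b ⇒ c)) ⇒ ((a ⇒ b) ⇒ (a ⇒ c)))
  Int-S x y z = Int-instance x y z s

  Int-refl : ∀ {a} → BoxFree a → Γ ⊢Int (a ⇒ a)
  Int-refl x = mp (Int-K x x) (mp (Int-K x (x ⇒ x)) (Int-S x (x ⇒ x) x))

  Int-trans : ∀ {a b c} → BoxFree a → BoxFree b → BoxFree c →
              Γ ⊢Int (a ⇒ b) → Γ ⊢Int (b ⇒ c) → Γ ⊢Int (a ⇒ c)
  Int-trans x y z ab bc = mp ab (mp (mp bc (Int-K (y ⇒ z) x)) (Int-S x y z))

  erase-AxmHC : ∀ {φ} → AxmHC φ → Γ ⊢Int erase φ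
  erase-AxmHC (int axiom) = subst (Γ ⊢Int_) (sym (erase-Ax₀ axiom)) (ax axiom)
  erase-AxmHC K  = Int-refl (var 0 ⇒ var 1)
  erase-AxmHC T′ = Int-refl (var 0)
  erase-AxmHC KM = Int-trans (var 0) (var 1 ⇒ var 0) (var 1 ∨ (var 1 ⇒ var 0))
                     (Int-K (var 0) (var 1))
                     (Int-instance (var 1) (var 1 ⇒ var 0) (var 0) ∨i₂)

  ⊢mHC⇒⊢Int-erase : (∀ B → Γ B → BoxFree B) → ∀ {φ} → Γ ⊢mHC φ → Γ ⊢Int erase φ
  ⊢mHC⇒⊢Int-erase Γ-boxFree (ax axiom) = erase-AxmHC axiom
  ⊢mHC⇒⊢Int-erase Γ-boxFree (prem {φ} γ) =
    subst (Γ ⊢Int_) (sym (erase-boxFree-id (Γ-boxFree φ γ))) (prem γ)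
  ⊢mHC⇒⊢Int-erase Γ-boxFree (sub {φ} σ d) =
    subst (Γ ⊢Int_) (sym (erase-⟨⟩ φ σ))
      (sub _ (λ n → erase-boxFree (σ n)) (⊢mHC⇒⊢Int-erase Γ-boxFree d))
  ⊢mHC⇒⊢Int-erase Γ-boxFree (mp d e) =
    mp (⊢mHC⇒⊢Int-erase Γ-boxFree d) (⊢mHC⇒⊢Int-erase Γ-boxFree e)

  ⊢Int⇒⊢mHC : ∀ {φ} → Γ ⊢Int φ → Γ ⊢mHC φ
  ⊢Int⇒⊢mHC (ax axiom)  = ax (int axiom)
  ⊢Int⇒⊢mHC (prem γ)    = prem γ
  ⊢Int⇒⊢mHC (sub σ _ d) = sub σ (⊢Int⇒⊢mHC d)
  ⊢Int⇒⊢mHC (mp d e)    = mp (⊢Int⇒⊢mHC d) (⊢Int⇒⊢mHC e)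

corollary4p3 : (Γ : Pred Formula 0ℓ) (A : Formula) → (∀ B → Γ B → BoxFree B) → BoxFree A → (Γ ⊢mHC A) ⇔ (Γ ⊢Int A)
corollary4p3 Γ A Γ-boxFree A-boxFree = mk⇔ mHC⇒Int ⊢Int⇒⊢mHC
  where
  mHC⇒Int : Γ ⊢mHC A → Γ ⊢Int A
  mHC⇒Int d = subst (Γ ⊢Int_) (erase-boxFree-id A-boxFree) (⊢mHC⇒⊢Int-erase Γ-boxFree d)
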